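{- Let $\mathbf{f}$ be the Fibonacci word. If $k\ge2$ and $n+1<F_k$, then $\operatorname{nsc}_{\mathbf{f}}(n)\le F_{k-1}$.
   Context: The Fibonacci word is $\mathbf{f}=\phi^{\omega}(0)$, the fixed point of $\phi(0)=01$, $\phi(1)=0$. The Fibonacci sequence is $F_0=1$, $F_1=2$, $F_k=F_{k-1}+F_{k-2}$ for $k\ge2$. For an infinite word $\mathbf{x}=x_0x_1x_2\cdots$ (indexed from $0$) and $n\ge1$, $\operatorname{nsc}_{\mathbf{x}}(n)=\max\{m\in\mathbb{N}: x_i\cdots x_{i+n-1}\neq x_j\cdots x_{j+n-1}\text{ for all } 0\le i<j\le m-1\}$. -}

module Defs where

open import Data.Nat using (ℕ; zero; suc; _+_; _<_; _≤_)
open import Data.List using (List; []; _∷_; _++_; concatMap; lookup; length)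
open import Data.Maybe using (Maybe; just; nothing)
open import Relation.Binary.PropositionalEquality using (_≡_)
open import Relation.Nullary using (¬_)

φ : ℕ → List ℕ
φ zero = 0 ∷ 1 ∷ []
φ (suc _) = 0 ∷ []

φ* : List ℕ → List ℕ
φ* = concatMap φ

φpow : ℕ → List ℕ
φpow zero = 0 ∷ []
φpow (suc k) = φ* (φpow k)

at : List ℕ → ℕ → ℕ
at [] _ = 0
at (x ∷ xs) zero = x
at (x ∷ xs) (suc i) = at xs i

-- Fibonacci word f = φ^ω(0), indexed from 0.  φ^(i+1)(0) has length ≥ i+1
-- and is a prefix of φ^ω(0), so f i is its i-th letter.
fib-word : ℕ → ℕ
fib-word i = at (φpow (suc i)) i

-- Fibonacci numbers with F 0 = 1, F 1 = 2
F : ℕ → ℕ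
F zero = 1
F (suc zero) = 2
F (suc (suc k)) = F (suc k) + F k

SameFactor : (ℕ → ℕ) → ℕ → ℕ → ℕ → Set
SameFactor x n i j = ∀ t → t < n → x (i + t) ≡ x (j + t)

FirstDistinct : (ℕ → ℕ) → ℕ → ℕ → Set
FirstDistinct x n m = ∀ i j → i < j → j < m → ¬ SameFactor x n i j

-- nsc_x(n) ≤ B : the maximum of {m : FirstDistinct x n m} is at most B,
-- i.e. every element of that set is at most B
nsc≤ : (ℕ → ℕ) → ℕ → ℕ → Set
nsc≤ x n B = ∀ m → FirstDistinct x n m → m ≤ B

-- Write Φₖ = φᵏ(0), so |Φₖ| = Fₖ and Φₖ₊₂ = Φₖ₊₁Φₖ.  The two
-- products Φₖ₊₁Φₖ and ΦₖΦₖ₊₁ agree except that their last two letters are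
-- swapped (induction on k).  Hence the word
--   Φⱼ₊₃ = Φⱼ₊₂Φⱼ₊₁ = Φⱼ₊₁(ΦⱼΦⱼ₊₁)
-- starts with Φⱼ₊₁ followed by the first Fⱼ₊₂ - 2 letters of Φⱼ₊₁Φⱼ = Φⱼ₊₂,
-- i.e. f has period Fⱼ₊₁ on its first Fⱼ₊₂ - 2 positions.  For k = j + 2
-- and n + 1 < Fₖ, the length-n factors of f at positions 0 and Fₖ₋₁ thus
-- coincide, so no m > Fₖ₋₁ has its first m factors pairwise distinct.
module Submission where

open import Defs
open import Data.Nat using (ℕ; zero; suc; _+_; _∸_; _<_; _≤_; z≤n; s≤s)
open import Data.Nat.Properties
open import Data.List using (List; []; _∷_; _++_; length)
open import Data.List.Properties using (++-assoc; ++-identityʳ; length-++)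
open import Data.Product using (Σ; ∃; _×_; _,_)
open import Relation.Binary.PropositionalEquality
open import Relation.Nullary using (yes; no)
open import Data.Empty using (⊥-elim)

at-++ˡ : ∀ (xs ys : List ℕ) i → i < length xs → at (xs ++ ys) i ≡ at xs i
at-++ˡ (x ∷ xs) ys zero    _       = refl
at-++ˡ (x ∷ xs) ys (suc i) (s≤s p) = at-++ˡ xs ys i p

at-++ʳ : ∀ (xs ys : List ℕ) i → at (xs ++ ys) (length xs + i) ≡ at ys i
at-++ʳ []       ys i = refl
at-++ʳ (x ∷ xs) ys i = at-++ʳ xs ys i

φ*-++ : ∀ xs ys → φ* (xs ++ ys) ≡ φ* xs ++ φ* ys
φ*-++ []       ys = refl
φ*-++ (x ∷ xs) ys =
  trans (cong (φ x ++_) (φ*-++ xs ys)) (sym (++-assoc (φ x) (φ* xs) (φ* ys)))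

φpow-rec : ∀ k → φpow (suc (suc k)) ≡ φpow (suc k) ++ φpow k
φpow-rec zero    = refl
φpow-rec (suc k) = trans (cong φ* (φpow-rec k)) (φ*-++ (φpow (suc k)) (φpow k))

length-φpow : ∀ k → length (φpow k) ≡ F k
length-φpow zero          = refl
length-φpow (suc zero)    = refl
length-φpow (suc (suc k)) = begin
  length (φpow (suc (suc k)))             ≡⟨ cong length (φpow-rec k) ⟩
  length (φpow (suc k) ++ φpow k)         ≡⟨ length-++ (φpow (suc k)) ⟩
  length (φpow (suc k)) + length (φpow k) ≡⟨ cong₂ _+_ (length-φpow (suc k)) (length-φpow k) ⟩
  F (suc k) + F k                         ∎
  where open ≡-Reasoning

k<F : ∀ k → k < F k
k<F zero          = s≤s z≤n
k<F (suc zero)    = s≤s (s≤s z≤n)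
k<F (suc (suc k)) = subst (_≤ F (suc (suc k))) (+-comm (suc (suc k)) 1)
  (+-mono-≤ (k<F (suc k)) (≤-trans (s≤s z≤n) (k<F k)))

φpow-prefix-step : ∀ k → ∃ λ r → φpow (suc k) ≡ φpow k ++ r
φpow-prefix-step zero    = 1 ∷ [] , refl
φpow-prefix-step (suc k) = φpow k , φpow-rec k

φpow-prefix : ∀ d a → ∃ λ r → φpow (d + a) ≡ φpow a ++ r
φpow-prefix zero    a = [] , sym (++-identityʳ (φpow a))
φpow-prefix (suc d) a with φpow-prefix d a | φpow-prefix-step (d + a)
... | r , eq | s , eq′ = r ++ s , (begin
  φpow (suc (d + a))    ≡⟨ eq′ ⟩
  φpow (d + a) ++ s     ≡⟨ cong (_++ s) eq ⟩
  (φpow a ++ r) ++ s    ≡⟨ ++-assoc (φpow a) r s ⟩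
  φpow a ++ (r ++ s)    ∎)
  where open ≡-Reasoning

at-φpow-stable : ∀ d a i → i < length (φpow a) → at (φpow (d + a)) i ≡ at (φpow a) i
at-φpow-stable d a i i<|Φₐ| with φpow-prefix d a
... | r , eq = trans (cong (λ w → at w i) eq) (at-++ˡ (φpow a) r i i<|Φₐ|)

-- f agrees with every Φₘ on the positions of Φₘ, since both Φᵢ₊₁ (which
-- defines fᵢ) and Φₘ are prefixes of Φₘ₊ᵢ₊₁.
fib-word-at : ∀ m i → i < length (φpow m) → fib-word i ≡ at (φpow m) i
fib-word-at m i i<|Φₘ| = begin
  at (φpow (suc i)) i         ≡⟨ sym (at-φpow-stable m (suc i) i i<|Φᵢ₊₁|) ⟩
  at (φpow (m + suc i)) i     ≡⟨ cong (λ z → at (φpow z) i) (+-comm m (suc i)) ⟩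
  at (φpow (suc i + m)) i     ≡⟨ at-φpow-stable (suc i) m i i<|Φₘ| ⟩
  at (φpow m) i               ∎
  where
  open ≡-Reasoning
  i<|Φᵢ₊₁| : i < length (φpow (suc i))
  i<|Φᵢ₊₁| = subst (i <_) (sym (length-φpow (suc i))) (<-trans (n<1+n i) (k<F (suc i)))

fib-word-prefix : ∀ m xs ys i → φpow m ≡ xs ++ ys → i < length xs →
  fib-word i ≡ at xs i
fib-word-prefix m xs ys i eq i<|xs| = begin
  fib-word i        ≡⟨ fib-word-at m i (subst (i <_) (cong length (sym eq)) i<|xs++ys|) ⟩
  at (φpow m) i     ≡⟨ cong (λ w → at w i) eq ⟩
  at (xs ++ ys) i   ≡⟨ at-++ˡ xs ys i i<|xs| ⟩
  at xs i           ∎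
  where
  open ≡-Reasoning
  i<|xs++ys| : i < length (xs ++ ys)
  i<|xs++ys| = subst (i <_) (sym (length-++ xs)) (≤-trans i<|xs| (m≤m+n _ _))

-- The inductive step uses Φₖ₊₂Φₖ₊₁ = Φₖ₊₁(ΦₖΦₖ₊₁) and
-- Φₖ₊₁Φₖ₊₂ = Φₖ₊₁(Φₖ₊₁Φₖ), so the roles of a and b swap.
φpow-near-commute : ∀ k → Σ (List ℕ) λ w → Σ ℕ λ a → Σ ℕ λ b →
  (φpow (suc k) ++ φpow k ≡ w ++ a ∷ b ∷ []) ×
  (φpow k ++ φpow (suc k) ≡ w ++ b ∷ a ∷ [])
φpow-near-commute zero = 0 ∷ [] , 1 , 0 , refl , refl
φpow-near-commute (suc k) with φpow-near-commute k
... | w , a , b , e₁ , e₂ = Φ ++ w , b , a ,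
  (begin
    φpow (suc (suc k)) ++ Φ   ≡⟨ cong (_++ Φ) (φpow-rec k) ⟩
    (Φ ++ φpow k) ++ Φ        ≡⟨ ++-assoc Φ (φpow k) Φ ⟩
    Φ ++ (φpow k ++ Φ)        ≡⟨ cong (Φ ++_) e₂ ⟩
    Φ ++ (w ++ b ∷ a ∷ [])    ≡⟨ sym (++-assoc Φ w _) ⟩
    (Φ ++ w) ++ b ∷ a ∷ []    ∎) ,
  (begin
    Φ ++ φpow (suc (suc k))   ≡⟨ cong (Φ ++_) (φpow-rec k) ⟩
    Φ ++ (Φ ++ φpow k)        ≡⟨ cong (Φ ++_) e₁ ⟩
    Φ ++ (w ++ a ∷ b ∷ [])    ≡⟨ sym (++-assoc Φ w _) ⟩
    (Φ ++ w) ++ a ∷ b ∷ []    ∎)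
  where
  open ≡-Reasoning
  Φ : List ℕ
  Φ = φpow (suc k)

-- Periodicity: f has period Fⱼ₊₁ on its first Fⱼ₊₂ - 2 positions.  Writing
-- Φⱼ₊₂ = w a b, both f₀…f_{|w|-1} and the block of Φⱼ₊₃ = Φⱼ₊₁ w b a after
-- Φⱼ₊₁ spell w.
fib-word-period : ∀ j t → t + 2 < F (suc (suc j)) →
  fib-word t ≡ fib-word (F (suc j) + t)
fib-word-period j t t+2<F with φpow-near-commute j
... | w , a , b , e₁ , e₂ = trans (fib-word-prefix (suc (suc j)) w _ t Φⱼ₊₂≡wab t<|w|)
                                  (sym fₜ₊F≡wₜ)
  where
  open ≡-Reasoning
  Φ : List ℕ
  Φ = φpow (suc j)

  Φⱼ₊₂≡wab : φpow (suc (suc j)) ≡ w ++ a ∷ b ∷ []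
  Φⱼ₊₂≡wab = trans (φpow-rec j) e₁

  Φⱼ₊₃≡Φwba : φpow (suc (suc (suc j))) ≡ (Φ ++ w) ++ b ∷ a ∷ []
  Φⱼ₊₃≡Φwba = begin
    φpow (suc (suc (suc j)))    ≡⟨ φpow-rec (suc j) ⟩
    φpow (suc (suc j)) ++ Φ     ≡⟨ cong (_++ Φ) (φpow-rec j) ⟩
    (Φ ++ φpow j) ++ Φ          ≡⟨ ++-assoc Φ (φpow j) Φ ⟩
    Φ ++ (φpow j ++ Φ)          ≡⟨ cong (Φ ++_) e₂ ⟩
    Φ ++ (w ++ b ∷ a ∷ [])      ≡⟨ sym (++-assoc Φ w _) ⟩
    (Φ ++ w) ++ b ∷ a ∷ []      ∎

  |w|+2≡F : length w + 2 ≡ F (suc (suc j))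
  |w|+2≡F = begin
    length w + 2                ≡⟨ sym (length-++ w) ⟩
    length (w ++ a ∷ b ∷ [])    ≡⟨ cong length (sym Φⱼ₊₂≡wab) ⟩
    length (φpow (suc (suc j))) ≡⟨ length-φpow (suc (suc j)) ⟩
    F (suc (suc j))             ∎

  t<|w| : t < length w
  t<|w| = +-cancelʳ-< 2 t (length w) (subst (t + 2 <_) (sym |w|+2≡F) t+2<F)

  |Φ|≡F : length Φ ≡ F (suc j)
  |Φ|≡F = length-φpow (suc j)

  F+t<|Φw| : F (suc j) + t < length (Φ ++ w)
  F+t<|Φw| = subst (F (suc j) + t <_)
    (sym (trans (length-++ Φ) (cong (_+ length w) |Φ|≡F)))
    (+-monoʳ-< (F (suc j)) t<|w|)

  fₜ₊F≡wₜ : fib-word (F (suc j) + t) ≡ at w t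
  fₜ₊F≡wₜ = begin
    fib-word (F (suc j) + t)        ≡⟨ fib-word-prefix (suc (suc (suc j))) (Φ ++ w) _ _ Φⱼ₊₃≡Φwba F+t<|Φw| ⟩
    at (Φ ++ w) (F (suc j) + t)     ≡⟨ cong (λ z → at (Φ ++ w) (z + t)) (sym |Φ|≡F) ⟩
    at (Φ ++ w) (length Φ + t)      ≡⟨ at-++ʳ Φ w t ⟩
    at w t                          ∎

mainTheorem9 : (k n : ℕ) → 2 ≤ k → 1 ≤ n → n + 1 < F k →
    nsc≤ fib-word n (F (k ∸ 1))
mainTheorem9 (suc zero)    n (s≤s ()) _ _ _ _
mainTheorem9 (suc (suc j)) n _ _ n+1<F m distinct with m ≤? F (suc j)
... | yes m≤F = m≤F
... | no  m≰F = ⊥-elim (distinct 0 (F (suc j)) 0<F (≰⇒> m≰F) sameFactor)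
  where
  0<F : 0 < F (suc j)
  0<F = ≤-trans (s≤s z≤n) (k<F (suc j))
  sameFactor : SameFactor fib-word n 0 (F (suc j))
  sameFactor t t<n = fib-word-period j t
    (≤-trans (+-monoˡ-≤ 2 t<n) (subst (_≤ F (suc (suc j))) (sym (+-suc n 1)) n+1<F))
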